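{- Let $p\le q$ be $n$-symmetric lattice paths and $0\le k\le n$. The bases of the $k$-th homogeneous component $\Delta[p,q]^k$ are exactly the sets $\operatorname{lab}^L(r)\cap[n]$ for the $n$-symmetric lattice paths $r$ with $p\le r\le q$ that pass through the point $(n-k,k)$; these are in bijection with such paths $r$.
   Context: An $n$-symmetric lattice path is a path from $(0,0)$ to $(n,n)$ of $2n$ unit steps $E=(1,0)$, $N=(0,1)$, a word $\alpha_1\cdots\alpha_{2n}$ with $\alpha_i\ne\alpha_{2n-i+1}$ for $i\le n$; $p\le r$ means $p$ lies weakly below $r$. $\operatorname{lab}^L(r)$: label steps in order by $-n,\dots,-1,1,\dots,n$ and record the labels of $E$ steps. $\Delta[p,q]$ is the delta matroid on $[n]$ with feasible sets $\operatorname{lab}^L(r)\cap[n]$ for symmetric $r$, $p\le r\le q$. The $k$-th homogeneous component of a delta matroid is the matroid whose bases are the feasible sets of size $k$. -}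

module Defs where

open import Data.Nat using (ℕ; zero; suc; _+_; _≤_)
open import Data.Fin using (Fin; _↑ˡ_; _↑ʳ_; opposite)
open import Data.Fin.Subset using (Subset; ∣_∣)
open import Data.Vec using (Vec; []; _∷_; lookup; tabulate)
open import Data.Bool using (Bool; true; false)
open import Data.Product using (Σ; _×_; ∃-syntax)
open import Relation.Binary.PropositionalEquality using (_≡_; _≢_)

-- unit steps E = (1,0) and N = (0,1)
data Step : Set where
  E N : Step

-- a lattice path from (0,0) with 2n steps, as a word α₁ ⋯ α₂ₙ
-- (position i : Fin (n + n) is the 0-based index; α_{i+1} in the paper)
Path : ℕ → Set
Path n = Vec Step (n + n)

-- n-symmetric: α_i ≠ α_{2n-i+1} for i ≤ n  (0-based: i and 2n-1-i, i < n)
Symmetric : (n : ℕ) → Path n → Set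
Symmetric n α = (i : Fin n) → lookup α (i ↑ˡ n) ≢ lookup α (opposite (i ↑ˡ n))

heightAfter : ∀ {l} → Vec Step l → ℕ → ℕ
heightAfter []       m       = 0
heightAfter (s ∷ α)  zero    = 0
heightAfter (E ∷ α)  (suc m) = heightAfter α m
heightAfter (N ∷ α)  (suc m) = suc (heightAfter α m)

Below : (n : ℕ) → Path n → Path n → Set
Below n p r = (m : ℕ) → m ≤ n + n → heightAfter p m ≤ heightAfter r m

isE : Step → Bool
isE E = true
isE N = false

-- lab^L(r) ∩ [n] : steps n+1,…,2n (0-based n + j) carry labels j+1 ∈ [n];
-- as a subset of Fin n (j ↦ label j+1), j is in the set iff that step is E.
labPos : (n : ℕ) → Path n → Subset n
labPos n r = tabulate (λ j → isE (lookup r (n ↑ʳ j)))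

-- r passes through the point (n-k, k): after n steps it has height k
PassesThrough : (n k : ℕ) → Path n → Set
PassesThrough n k r = heightAfter r n ≡ k

Between : (n : ℕ) → Path n → Path n → Path n → Set
Between n p q r = Symmetric n r × Below n p r × Below n r q

Feasible : (n : ℕ) → Path n → Path n → Subset n → Set
Feasible n p q S = ∃[ r ] (Between n p q r × labPos n r ≡ S)

IsBasis : (n : ℕ) → Path n → Path n → ℕ → Subset n → Set
IsBasis n p q k S = Feasible n p q S × ∣ S ∣ ≡ k

-- In a symmetric path the i-th step of the first half is the mirror image of
-- the i-th step from the end, so the N steps among the first n steps are in
-- bijection with the E steps among the last n; i.e. the height reached on the
-- anti-diagonal x + y = n is |lab^L(r) ∩ [n]|.  Hence a feasible set has size
-- k exactly when its path passes through (n - k, k).  Moreover the second half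
-- of a symmetric path is read off from its label set and determines the first
-- half, so r ↦ lab^L(r) ∩ [n] is injective on symmetric paths.
module Submission where

open import Defs
open import Data.Nat using (ℕ; _≤_; suc; _+_; _∸_)
open import Data.Nat.Properties using (+-∸-assoc; +-0-commutativeMonoid)
open import Data.Fin using (Fin; zero; suc; toℕ; _↑ˡ_; _↑ʳ_; opposite)
open import Data.Fin.Properties using (toℕ-injective; toℕ-↑ˡ; toℕ-↑ʳ; opposite-prop; toℕ<n)
import Data.Fin.Permutation as Permutation
open import Data.Fin.Subset using (Subset; ∣_∣)
open import Data.Vec using (Vec; []; _∷_; lookup; tabulate; map; _++_; splitAt)
open import Data.Vec.Properties
  using (lookup-++ˡ; lookup-++ʳ; lookup∘tabulate; tabulate∘lookup; tabulate-∘; tabulate-cong)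
open import Data.Bool using (Bool; true; false; if_then_else_)
open import Data.Empty using (⊥-elim)
open import Data.Product using (_×_; ∃-syntax; _,_)
open import Function using (_∘_)
open import Function.Bundles using (_⇔_; mk⇔)
open import Relation.Binary.PropositionalEquality
  using (_≡_; _≢_; refl; sym; trans; cong; cong₂; module ≡-Reasoning)
open import Algebra.Properties.CommutativeMonoid.Sum +-0-commutativeMonoid
  using (sum; sum-cong-≗; sum-permute)

open ≡-Reasoning

count : ∀ {m} → (Fin m → Bool) → ℕ
count f = sum (λ i → if f i then 1 else 0)

count-cong : ∀ {m} {f g : Fin m → Bool} → (∀ i → f i ≡ g i) → count f ≡ count g
count-cong f≗g = sum-cong-≗ (λ i → cong (λ b → if b then 1 else 0) (f≗g i))

count-∘-opposite : ∀ {m} (f : Fin m → Bool) → count (f ∘ opposite) ≡ count f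
count-∘-opposite f = sym (sum-permute (λ i → if f i then 1 else 0) Permutation.reverse)

∣tabulate∣≡count : ∀ {m} (f : Fin m → Bool) → ∣ tabulate f ∣ ≡ count f
∣tabulate∣≡count {0} f = refl
∣tabulate∣≡count {suc m} f with f zero
... | true  = cong suc (∣tabulate∣≡count (f ∘ suc))
... | false = ∣tabulate∣≡count (f ∘ suc)

opposite-↑ˡ : ∀ {n} (i : Fin n) → opposite (i ↑ˡ n) ≡ n ↑ʳ opposite i
opposite-↑ˡ {n} i = toℕ-injective (begin
  toℕ (opposite (i ↑ˡ n))    ≡⟨ opposite-prop (i ↑ˡ n) ⟩
  n + n ∸ suc (toℕ (i ↑ˡ n)) ≡⟨ cong (λ t → n + n ∸ suc t) (toℕ-↑ˡ i n) ⟩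
  n + n ∸ suc (toℕ i)        ≡⟨ +-∸-assoc n (toℕ<n i) ⟩
  n + (n ∸ suc (toℕ i))      ≡⟨ cong (n +_) (opposite-prop i) ⟨
  n + toℕ (opposite i)       ≡⟨ toℕ-↑ʳ n (opposite i) ⟨
  toℕ (n ↑ʳ opposite i)      ∎)

mirror : Step → Step
mirror E = N
mirror N = E

≢⇒≡mirror : ∀ {a b : Step} → a ≢ b → a ≡ mirror b
≢⇒≡mirror {E} {E} a≢b = ⊥-elim (a≢b refl)
≢⇒≡mirror {E} {N} _   = refl
≢⇒≡mirror {N} {E} _   = refl
≢⇒≡mirror {N} {N} a≢b = ⊥-elim (a≢b refl)

isN : Step → Bool
isN E = false
isN N = true

isN∘mirror : ∀ s → isN (mirror s) ≡ isE s
isN∘mirror E = refl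
isN∘mirror N = refl

stepOf : Bool → Step
stepOf true  = E
stepOf false = N

stepOf∘isE : ∀ s → stepOf (isE s) ≡ s
stepOf∘isE E = refl
stepOf∘isE N = refl

heightAfter-++ : ∀ {m l} (xs : Vec Step m) (ys : Vec Step l) →
                 heightAfter (xs ++ ys) m ≡ count (isN ∘ lookup xs)
heightAfter-++ []       []       = refl
heightAfter-++ []       (_ ∷ _)  = refl
heightAfter-++ (E ∷ xs) ys       = heightAfter-++ xs ys
heightAfter-++ (N ∷ xs) ys       = cong suc (heightAfter-++ xs ys)

lookup-labPos : ∀ {n} (xs ys : Vec Step n) j → lookup (labPos n (xs ++ ys)) j ≡ isE (lookup ys j)
lookup-labPos xs ys j = trans (lookup∘tabulate _ j) (cong isE (lookup-++ʳ xs ys j))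

symmetric-++ : ∀ {n} (xs ys : Vec Step n) → Symmetric n (xs ++ ys) →
               ∀ i → lookup xs i ≡ mirror (lookup ys (opposite i))
symmetric-++ {n} xs ys symmetric i = ≢⇒≡mirror (λ xᵢ≡y → symmetric i (begin
  lookup (xs ++ ys) (i ↑ˡ n)             ≡⟨ lookup-++ˡ xs ys i ⟩
  lookup xs i                            ≡⟨ xᵢ≡y ⟩
  lookup ys (opposite i)                 ≡⟨ lookup-++ʳ xs ys (opposite i) ⟨
  lookup (xs ++ ys) (n ↑ʳ opposite i)    ≡⟨ cong (lookup (xs ++ ys)) (opposite-↑ˡ i) ⟨
  lookup (xs ++ ys) (opposite (i ↑ˡ n))  ∎))

heightAfter-half≡∣labPos∣ : ∀ {n} (r : Path n) → Symmetric n r → heightAfter r n ≡ ∣ labPos n r ∣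
heightAfter-half≡∣labPos∣ {n} r symmetric with splitAt n r
... | xs , ys , refl = begin
  heightAfter (xs ++ ys) n
    ≡⟨ heightAfter-++ xs ys ⟩
  count (isN ∘ lookup xs)
    ≡⟨ count-cong (λ i → cong isN (symmetric-++ xs ys symmetric i)) ⟩
  count (isN ∘ mirror ∘ lookup ys ∘ opposite)
    ≡⟨ count-cong (isN∘mirror ∘ lookup ys ∘ opposite) ⟩
  count (isE ∘ lookup ys ∘ opposite)
    ≡⟨ count-∘-opposite (isE ∘ lookup ys) ⟩
  count (isE ∘ lookup ys)
    ≡⟨ count-cong (cong isE ∘ lookup-++ʳ xs ys) ⟨
  count (isE ∘ lookup (xs ++ ys) ∘ (n ↑ʳ_))
    ≡⟨ ∣tabulate∣≡count (isE ∘ lookup (xs ++ ys) ∘ (n ↑ʳ_)) ⟨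
  ∣ labPos n (xs ++ ys) ∣
    ∎

fromLabels : ∀ {n} → Subset n → Path n
fromLabels S = tabulate (mirror ∘ stepOf ∘ lookup S ∘ opposite) ++ map stepOf S

fromLabels∘labPos : ∀ {n} (r : Path n) → Symmetric n r → fromLabels (labPos n r) ≡ r
fromLabels∘labPos {n} r symmetric with splitAt n r
... | xs , ys , refl = cong₂ _++_ firstHalf secondHalf
  where
  stepOf∘lookup-labPos : ∀ j → stepOf (lookup (labPos n (xs ++ ys)) j) ≡ lookup ys j
  stepOf∘lookup-labPos j = trans (cong stepOf (lookup-labPos xs ys j)) (stepOf∘isE (lookup ys j))

  firstHalf : tabulate (mirror ∘ stepOf ∘ lookup (labPos n (xs ++ ys)) ∘ opposite) ≡ xs
  firstHalf = begin
    tabulate (mirror ∘ stepOf ∘ lookup (labPos n (xs ++ ys)) ∘ opposite)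
      ≡⟨ tabulate-cong (cong mirror ∘ stepOf∘lookup-labPos ∘ opposite) ⟩
    tabulate (mirror ∘ lookup ys ∘ opposite)
      ≡⟨ tabulate-cong (symmetric-++ xs ys symmetric) ⟨
    tabulate (lookup xs)
      ≡⟨ tabulate∘lookup xs ⟩
    xs
      ∎

  secondHalf : map stepOf (labPos n (xs ++ ys)) ≡ ys
  secondHalf = begin
    map stepOf (labPos n (xs ++ ys))
      ≡⟨ cong (map stepOf) (tabulate∘lookup (labPos n (xs ++ ys))) ⟨
    map stepOf (tabulate (lookup (labPos n (xs ++ ys))))
      ≡⟨ tabulate-∘ stepOf (lookup (labPos n (xs ++ ys))) ⟨
    tabulate (stepOf ∘ lookup (labPos n (xs ++ ys)))
      ≡⟨ tabulate-cong stepOf∘lookup-labPos ⟩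
    tabulate (lookup ys)
      ≡⟨ tabulate∘lookup ys ⟩
    ys
      ∎

labPos-injective : ∀ {n} (r r′ : Path n) → Symmetric n r → Symmetric n r′ →
                   labPos n r ≡ labPos n r′ → r ≡ r′
labPos-injective {n} r r′ symmetric symmetric′ labPos≡ = begin
  r                        ≡⟨ fromLabels∘labPos r symmetric ⟨
  fromLabels (labPos n r)  ≡⟨ cong fromLabels labPos≡ ⟩
  fromLabels (labPos n r′) ≡⟨ fromLabels∘labPos r′ symmetric′ ⟩
  r′                       ∎

proposition3p15 : (n : ℕ) (p q : Path n) → Symmetric n p → Symmetric n q → Below n p q
    → (k : ℕ) → k ≤ n
    → ((S : Subset n) → IsBasis n p q k S
         ⇔ (∃[ r ] (Between n p q r × PassesThrough n k r × labPos n r ≡ S)))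
      × ((r r′ : Path n) → Between n p q r → PassesThrough n k r
         → Between n p q r′ → PassesThrough n k r′
         → labPos n r ≡ labPos n r′ → r ≡ r′)
proposition3p15 n p q _ _ _ k _ = basis⇔passesThrough , injective
  where
  basis⇔passesThrough : (S : Subset n) → IsBasis n p q k S
    ⇔ (∃[ r ] (Between n p q r × PassesThrough n k r × labPos n r ≡ S))
  basis⇔passesThrough S = mk⇔
    (λ { ((r , between@(symmetric , _) , refl) , ∣S∣≡k) →
           r , between , trans (heightAfter-half≡∣labPos∣ r symmetric) ∣S∣≡k , refl })
    (λ { (r , between@(symmetric , _) , passes , refl) →
           (r , between , refl) , trans (sym (heightAfter-half≡∣labPos∣ r symmetric)) passes })

  injective : (r r′ : Path n) → Between n p q r → PassesThrough n k r
    → Between n p q r′ → PassesThrough n k r′ → labPos n r ≡ labPos n r′ → r ≡ r′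
  injective r r′ (symmetric , _) _ (symmetric′ , _) _ = labPos-injective r r′ symmetric symmetric′
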